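{- Let $\mathbf{X}$ and $\mathbf{Y}$ be topological spaces with carriers $X$ and $Y$, let $\mathcal U=\{U_i\}_{i\in I}$ be an indexed base of $\mathbf X$ and $\mathcal V=\{V_j\}_{j\in J}$ an indexed base of $\mathbf Y$, and let $f:E\to Y$ with $E\subseteq X$. Then a $(\mathcal U,\mathcal V)$-approximation system for $f$ exists if and only if $f$ is continuous (as a map from the subspace $E$ of $\mathbf X$ to $\mathbf Y$).
   Context: The spaces are not assumed to be $T_0$. A $(\mathcal U,\mathcal V)$-approximation system for $f$ is a subset $R\subseteq I\times J$ such that for every $x\in E$ and every $j\in J$: $f(x)\in V_j$ if and only if there exists $i$ with $(i,j)\in R$ and $x\in U_i$. -}

module Defs where

open import Level using (Level; _⊔_) renaming (suc to lsuc)
open import Data.Product using (Σ; _×_; _,_; proj₁)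
open import Data.Unit.Polymorphic using (⊤)
open import Function.Bundles using (_⇔_)

Subset : ∀ {a} (A : Set a) (ℓ : Level) → Set (a ⊔ lsuc ℓ)
Subset A ℓ = A → Set ℓ

_≐_ : ∀ {a ℓ} {A : Set a} → Subset A ℓ → Subset A ℓ → Set (a ⊔ ℓ)
P ≐ Q = ∀ x → P x ⇔ Q x

⋃ : ∀ {a ℓ} {A : Set a} (K : Set ℓ) → (K → Subset A ℓ) → Subset A ℓ
⋃ K F x = Σ K λ k → F k x

record Topology (a ℓ : Level) : Set (lsuc (a ⊔ ℓ)) where
  field
    Carrier  : Set a
    IsOpen   : Subset Carrier ℓ → Set ℓ
    open-ext : ∀ {U V} → U ≐ V → IsOpen U → IsOpen V
    open-univ : IsOpen (λ _ → ⊤)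
    open-∩   : ∀ {U V} → IsOpen U → IsOpen V → IsOpen (λ x → U x × V x)
    open-⋃   : (K : Set ℓ) (F : K → Subset Carrier ℓ) →
               (∀ k → IsOpen (F k)) → IsOpen (⋃ K F)

open Topology public

record IsIndexedBase {a ℓ} (T : Topology a ℓ) (I : Set ℓ)
                     (U : I → Subset (Carrier T) ℓ) : Set (lsuc ℓ ⊔ a) where
  field
    base-open  : ∀ i → IsOpen T (U i)
    base-union : ∀ O → IsOpen T O →
                 Σ (Subset I ℓ) λ S → O ≐ (λ x → Σ I λ i → S i × U i x)

-- Continuity of f : E → Y where E ⊆ X carries the subspace topology:
-- for every open V of Y, f⁻¹(V) is open in E, i.e. f⁻¹(V) = E ∩ O for
-- some open O of X.
ContinuousOn : ∀ {a b ℓ} (X : Topology a ℓ) (Y : Topology b ℓ)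
               (E : Subset (Carrier X) ℓ) →
               (Σ (Carrier X) E → Carrier Y) → Set (a ⊔ b ⊔ lsuc ℓ)
ContinuousOn {ℓ = ℓ} X Y E f =
  ∀ V → IsOpen Y V →
  Σ (Subset (Carrier X) ℓ) λ O → IsOpen X O ×
    (∀ (x : Carrier X) (e : E x) → V (f (x , e)) ⇔ O x)

IsApproximationSystem : ∀ {a b ℓ} {X : Set a} {Y : Set b} {I J : Set ℓ}
  (U : I → Subset X ℓ) (V : J → Subset Y ℓ) (E : Subset X ℓ)
  (f : Σ X E → Y) (R : I → J → Set ℓ) → Set (a ⊔ ℓ)
IsApproximationSystem {X = X} {I = I} {J = J} U V E f R =
  ∀ (x : X) (e : E x) (j : J) → V j (f (x , e)) ⇔ (Σ I λ i → R i j × U i x)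

-- An approximation system is exactly a base-level description of the
-- preimages of basic open sets.  If R is one, the preimage of an open
-- W = ⋃_{j∈S} V_j is E ∩ ⋃ {U_i | ∃ j ∈ S. (i,j) ∈ R}, which is open.
-- Conversely, if f is continuous then f⁻¹(V_j) = E ∩ O_j with O_j open,
-- and writing O_j as a union of basic sets U_i (i ∈ S_j) gives the
-- approximation system R i j := i ∈ S_j.
module Submission where

open import Defs
open import Level using (Level)
open import Data.Product using (Σ; _×_; _,_; proj₁; proj₂)
open import Function.Base using (_∘_)
open import Function.Bundles using (_⇔_; mk⇔; module Equivalence)
open import Function.Properties.Equivalence using () renaming (trans to ⇔-trans)
open IsIndexedBase

module _ {a b ℓ : Level} (X : Topology a ℓ) (Y : Topology b ℓ) {I J : Set ℓ}
         {U : I → Subset (Carrier X) ℓ} {V : J → Subset (Carrier Y) ℓ}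
         {E : Subset (Carrier X) ℓ} {f : Σ (Carrier X) E → Carrier Y} where

  ⋃-through : (I → J → Set ℓ) → Subset J ℓ → Subset (Carrier X) ℓ
  ⋃-through R S = ⋃ (Σ I λ i → Σ J λ j → S j × R i j) (U ∘ proj₁)

  ⋃-through-open : (∀ i → IsOpen X (U i)) →
                   ∀ R S → IsOpen X (⋃-through R S)
  ⋃-through-open U-open R S =
    open-⋃ X (Σ I λ i → Σ J λ j → S j × R i j) (U ∘ proj₁) (U-open ∘ proj₁)

  approximationSystem-preimage-⋃ :
    ∀ {R} → IsApproximationSystem U V E f R → ∀ S x e →
    (Σ J λ j → S j × V j (f (x , e))) ⇔ ⋃-through R S x
  approximationSystem-preimage-⋃ {R} approx S x e = mk⇔ to from
    where
    to : (Σ J λ j → S j × V j (f (x , e))) → ⋃-through R S x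
    to (j , s , v) with Equivalence.to (approx x e j) v
    ... | i , r , u = (i , j , s , r) , u

    from : ⋃-through R S x → Σ J λ j → S j × V j (f (x , e))
    from ((i , j , s , r) , u) = j , s , Equivalence.from (approx x e j) (i , r , u)

  approximationSystem⇒continuousOn :
    (∀ i → IsOpen X (U i)) → IsIndexedBase Y J V →
    ∀ {R} → IsApproximationSystem U V E f R → ContinuousOn X Y E f
  approximationSystem⇒continuousOn U-open V-base {R} approx W W-open =
    ⋃-through R S , ⋃-through-open U-open R S ,
    λ x e → ⇔-trans (W≐⋃S (f (x , e))) (approximationSystem-preimage-⋃ approx S x e)
    where
    S    = proj₁ (base-union V-base W W-open)
    W≐⋃S = proj₂ (base-union V-base W W-open)

  continuousOn⇒approximationSystem :
    IsIndexedBase X I U → (∀ j → IsOpen Y (V j)) →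
    ContinuousOn X Y E f → Σ (I → J → Set ℓ) (IsApproximationSystem U V E f)
  continuousOn⇒approximationSystem U-base V-open continuous =
    (λ i j → proj₁ (subfamily j) i) ,
    λ x e j → ⇔-trans (preimage≐O j x e) (proj₂ (subfamily j) x)
    where
    O : J → Subset (Carrier X) ℓ
    O j = proj₁ (continuous (V j) (V-open j))

    O-open : ∀ j → IsOpen X (O j)
    O-open j = proj₁ (proj₂ (continuous (V j) (V-open j)))

    preimage≐O : ∀ j x e → V j (f (x , e)) ⇔ O j x
    preimage≐O j = proj₂ (proj₂ (continuous (V j) (V-open j)))

    subfamily : ∀ j → Σ (Subset I ℓ) λ S → O j ≐ (λ x → Σ I λ i → S i × U i x)
    subfamily j = base-union U-base (O j) (O-open j)

proposition2p3 : ∀ {a b ℓ} (X : Topology a ℓ) (Y : Topology b ℓ)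
    (I J : Set ℓ) (U : I → Subset (Carrier X) ℓ) (V : J → Subset (Carrier Y) ℓ) →
    IsIndexedBase X I U → IsIndexedBase Y J V →
    (E : Subset (Carrier X) ℓ) (f : Σ (Carrier X) E → Carrier Y) →
    (Σ (I → J → Set ℓ) (IsApproximationSystem U V E f)) ⇔ ContinuousOn X Y E f
proposition2p3 X Y I J U V U-base V-base E f = mk⇔
  (λ (R , approx) → approximationSystem⇒continuousOn X Y (base-open U-base) V-base approx)
  (continuousOn⇒approximationSystem X Y U-base (base-open V-base))
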